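{- Let $\mathsf{L}$ be any one of $\mathbf{PD}$, $\mathsf{InqL}$, $\mathbf{PT}$. For all formulas $\phi,\psi$ in the language of $\mathsf{L}$ and every flat substitution $\sigma$ of $\mathsf{L}$: if $\phi\vdash_{\mathsf{L}}\psi$ then $\sigma(\phi)\vdash_{\mathsf{L}}\sigma(\psi)$. In particular, if $\phi\equiv\psi$ then $\sigma(\phi)\equiv\sigma(\psi)$.
   Context: Fix a countable set $\mathrm{Prop}$ of propositional variables. A valuation is a function $v:\mathrm{Prop}\to\{0,1\}$; a team is a set of valuations. Formulas of $\mathbf{PT}$ are given by $\phi::=p\mid\bot\mid\top\mid {=}(\phi,\dots,\phi,\phi)\mid\neg\phi\mid\phi\wedge\phi\mid\phi\otimes\phi\mid\phi\vee\phi\mid\phi\to\phi$. Team semantics: $X\models p$ iff $v(p)=1$ for all $v\in X$; $X\models\bot$ iff $X=\emptyset$; $X\models\top$ always; $X\models\phi\wedge\psi$ iff $X\models\phi$ and $X\models\psi$; $X\models\phi\otimes\psi$ iff $X=Y\cup Z$ for some $Y,Z\subseteq X$ with $Y\models\phi$, $Z\models\psi$; $X\models\phi\vee\psi$ iff $X\models\phi$ or $X\models\psi$; $X\models\phi\to\psi$ iff every $Y\subseteq X$ with $Y\models\phi$ satisfies $Y\models\psi$; $X\models\neg\phi$ iff $\{v\}\not\models\phi$ for all $v\in X$; $X\models{=}(\phi_1,\dots,\phi_n,\psi)$ iff $X\models\bigwedge_{i=1}^n(\phi_i\vee\neg\phi_i)\to(\psi\vee\neg\psi)$. A formula $\phi$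 is flat if for every team $X$: $X\models\phi$ iff $\{v\}\models\phi$ for all $v\in X$. Formulas of $\mathbf{PD}$: $\phi::=p\mid\bot\mid\top\mid{=}(\alpha_1,\dots,\alpha_k,\beta)\mid\neg\phi\mid\phi\wedge\phi\mid\phi\otimes\phi$ with $\alpha_i,\beta$ flat $\mathbf{PD}$-formulas, same semantics. Formulas of $\mathsf{InqL}$: built from $p,\bot,\top$ by $\wedge,\vee,\to$, same semantics. $\phi\vdash_{\mathsf{L}}\psi$ iff $\phi,\psi$ are in the language of $\mathsf{L}$ and every team satisfying $\phi$ satisfies $\psi$; $\phi\equiv\psi$ means each team satisfies $\phi$ iff it satisfies $\psi$. A substitution of $\mathsf{L}$ is a map from formulas of $\mathsf{L}$ to formulas of $\mathsf{L}$ commuting with all connectives and atoms; it is flat if $\sigma(p)$ is flat for every $p\in\mathrm{Prop}$. -}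

module Defs where

open import Level using (0ℓ)
open import Data.Nat using (ℕ)
open import Data.Bool using (Bool; true)
open import Data.List using (List; []; _∷_)
open import Data.Product using (_×_; Σ; _,_)
open import Data.Sum using (_⊎_)
open import Data.Empty using (⊥)
open import Data.Unit using () renaming (⊤ to Unit)
open import Relation.Nullary using (¬_)
open import Relation.Binary.PropositionalEquality using (_≡_)
open import Function.Bundles using (_⇔_)

Valuation : Set
Valuation = ℕ → Bool

Team : Set₁
Team = Valuation → Set

_⊆_ : Team → Team → Set
Y ⊆ X = ∀ v → Y v → X v

⟦_⟧ : Valuation → Team
⟦ v ⟧ = λ w → w ≡ v

_≐_∪_ : Team → Team → Team → Set
X ≐ Y ∪ Z = (Y ⊆ X) × (Z ⊆ X) × (∀ v → X v → Y v ⊎ Z v)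

-- Formulas of PT; dep φs ψ is =(φ₁,…,φₙ,ψ)
data Form : Set where
  var   : ℕ → Form
  bot   : Form
  top   : Form
  dep   : List Form → Form → Form
  neg   : Form → Form
  _∧'_  : Form → Form → Form
  _⊗_   : Form → Form → Form
  _∨'_  : Form → Form → Form
  _⇒_   : Form → Form → Form

mutual
  _⊨_ : Team → Form → Set₁
  X ⊨ var p   = Lift' (∀ v → X v → v p ≡ true)
  X ⊨ bot     = Lift' (∀ v → X v → ⊥)
  X ⊨ top     = Lift' Unit
  X ⊨ dep φs ψ = ∀ Y → Y ⊆ X → (Y ⊨all φs) → (Y ⊨ ψ ⊎ Y ⊨¬ ψ)
  X ⊨ neg φ   = X ⊨¬ φ
  X ⊨ (φ ∧' ψ) = (X ⊨ φ) × (X ⊨ ψ)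
  X ⊨ (φ ⊗ ψ) = Σ Team λ Y → Σ Team λ Z → Lift' (X ≐ Y ∪ Z) × (Y ⊨ φ) × (Z ⊨ ψ)
  X ⊨ (φ ∨' ψ) = (X ⊨ φ) ⊎ (X ⊨ ψ)
  X ⊨ (φ ⇒ ψ) = ∀ Y → Y ⊆ X → Y ⊨ φ → Y ⊨ ψ

  _⊨¬_ : Team → Form → Set₁
  X ⊨¬ φ = ∀ v → X v → ¬ (⟦ v ⟧ ⊨ φ)

  _⊨all_ : Team → List Form → Set₁
  Y ⊨all []       = Lift' Unit
  Y ⊨all (φ ∷ φs) = (Y ⊨ φ ⊎ Y ⊨¬ φ) × (Y ⊨all φs)

  Lift' : Set → Set₁
  Lift' A = Level.Lift (Level.suc 0ℓ) A

Flat : Form → Set₁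
Flat φ = ∀ (X : Team) → (X ⊨ φ) ⇔ (∀ v → X v → ⟦ v ⟧ ⊨ φ)

data Logic : Set where
  PD InqL PT : Logic

data InPD : Form → Set₁
data AllFlatPD : List Form → Set₁

data InPD where
  var  : ∀ p → InPD (var p)
  bot  : InPD bot
  top  : InPD top
  dep  : ∀ {αs β} → AllFlatPD αs → InPD β → Flat β → InPD (dep αs β)
  neg  : ∀ {φ} → InPD φ → InPD (neg φ)
  and  : ∀ {φ ψ} → InPD φ → InPD ψ → InPD (φ ∧' ψ)
  tensor : ∀ {φ ψ} → InPD φ → InPD ψ → InPD (φ ⊗ ψ)

data AllFlatPD where
  []  : AllFlatPD []
  _∷_ : ∀ {α αs} → (InPD α × Flat α) → AllFlatPD αs → AllFlatPD (α ∷ αs)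

data InInqL : Form → Set where
  var  : ∀ p → InInqL (var p)
  bot  : InInqL bot
  top  : InInqL top
  and  : ∀ {φ ψ} → InInqL φ → InInqL ψ → InInqL (φ ∧' ψ)
  or   : ∀ {φ ψ} → InInqL φ → InInqL ψ → InInqL (φ ∨' ψ)
  imp  : ∀ {φ ψ} → InInqL φ → InInqL ψ → InInqL (φ ⇒ ψ)

In : Logic → Form → Set₁
In PD   φ = InPD φ
In InqL φ = Level.Lift (Level.suc 0ℓ) (InInqL φ)
In PT   φ = Level.Lift (Level.suc 0ℓ) Unit

mutual
  subst : (ℕ → Form) → Form → Form
  subst s (var p)    = s p
  subst s bot        = bot
  subst s top        = top
  subst s (dep φs ψ) = dep (substs s φs) (subst s ψ)
  subst s (neg φ)    = neg (subst s φ)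
  subst s (φ ∧' ψ)   = subst s φ ∧' subst s ψ
  subst s (φ ⊗ ψ)    = subst s φ ⊗ subst s ψ
  subst s (φ ∨' ψ)   = subst s φ ∨' subst s ψ
  subst s (φ ⇒ ψ)    = subst s φ ⇒ subst s ψ

  substs : (ℕ → Form) → List Form → List Form
  substs s []       = []
  substs s (φ ∷ φs) = subst s φ ∷ substs s φs

IsSubstOf : Logic → (ℕ → Form) → Set₁
IsSubstOf L s = ∀ φ → In L φ → In L (subst s φ)

IsFlatSubst : (ℕ → Form) → Set₁
IsFlatSubst s = ∀ p → Flat (s p)

_⊢[_]_ : Form → Logic → Form → Set₁
φ ⊢[ L ] ψ = In L φ × In L ψ × (∀ (X : Team) → X ⊨ φ → X ⊨ ψ)

_≋_ : Form → Form → Set₁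
φ ≋ ψ = ∀ (X : Team) → (X ⊨ φ) ⇔ (X ⊨ ψ)

-- For a flat substitution σ, a singleton {v} satisfies σ(p) exactly when the
-- valuation vσ, vσ(p) = 1 iff {v} ⊨ σ(p), makes p true.  By induction on φ,
-- X ⊨ σ(φ) iff the image team {vσ | v ∈ X} satisfies φ: the only non-local
-- clauses quantify over subteams or splittings, and every subteam of the image
-- is the image of its preimage within X.  An entailment φ ⊨ ψ between images
-- therefore pulls back to σ(φ) ⊨ σ(ψ).
module Submission where

open import Defs
open import Data.Nat using (ℕ)
open import Level using (0ℓ; suc; lift)
open import Data.Bool using (true)
open import Data.Product using (_×_; _,_; Σ; proj₂)
open import Data.Product.Function.NonDependent.Propositional using (_×-⇔_)
open import Data.Empty using (⊥-elim)
open import Data.Sum using (_⊎_; inj₁; inj₂)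
open import Data.Sum.Function.Propositional using (_⊎-⇔_)
open import Data.List using ([]; _∷_)
open import Data.List.Relation.Binary.Pointwise using (Pointwise; []; _∷_)
open import Relation.Nullary using (does; yes; no)
open import Relation.Binary.PropositionalEquality using (_≡_; refl)
import Relation.Binary.PropositionalEquality as ≡
open import Function using (_∘_)
open import Function.Bundles using (_⇔_; mk⇔; Equivalence)
import Function.Properties.Equivalence as ⇔
open import Function.Related.TypeIsomorphisms using (→-cong-⇔)
open import Axiom.ExcludedMiddle using (ExcludedMiddle)

open Equivalence using (to; from)

_≈ᵀ_ : Team → Team → Set
X ≈ᵀ Y = X ⊆ Y × Y ⊆ X

≈ᵀ-sym : ∀ {X Y} → X ≈ᵀ Y → Y ≈ᵀ X
≈ᵀ-sym (X⊆Y , Y⊆X) = Y⊆X , X⊆Y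

⊨¬-antimono : ∀ φ {X Y} → Y ⊆ X → X ⊨¬ φ → Y ⊨¬ φ
⊨¬-antimono φ Y⊆X X⊨¬φ v = X⊨¬φ v ∘ Y⊆X v

⊨-resp-≈ᵀ : ∀ φ {X Y} → X ≈ᵀ Y → X ⊨ φ → Y ⊨ φ
⊨-resp-≈ᵀ (var p)    (_ , Y⊆X) (lift h)  = lift (λ v → h v ∘ Y⊆X v)
⊨-resp-≈ᵀ bot        (_ , Y⊆X) (lift h)  = lift (λ v → h v ∘ Y⊆X v)
⊨-resp-≈ᵀ top        _         h         = h
⊨-resp-≈ᵀ (dep φs ψ) (_ , Y⊆X) h Z Z⊆Y    = h Z (λ v → Y⊆X v ∘ Z⊆Y v)
⊨-resp-≈ᵀ (neg φ)    (_ , Y⊆X) h         = ⊨¬-antimono φ Y⊆X h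
⊨-resp-≈ᵀ (φ ∧' ψ)   e         (hφ , hψ) = ⊨-resp-≈ᵀ φ e hφ , ⊨-resp-≈ᵀ ψ e hψ
⊨-resp-≈ᵀ (φ ⊗ ψ)    (X⊆Y , Y⊆X) (Z₁ , Z₂ , lift (Z₁⊆X , Z₂⊆X , cover) , h₁ , h₂) =
  Z₁ , Z₂ ,
  lift ((λ v → X⊆Y v ∘ Z₁⊆X v) , (λ v → X⊆Y v ∘ Z₂⊆X v) , (λ v → cover v ∘ Y⊆X v)) ,
  h₁ , h₂
⊨-resp-≈ᵀ (φ ∨' ψ)   e         (inj₁ h)  = inj₁ (⊨-resp-≈ᵀ φ e h)
⊨-resp-≈ᵀ (φ ∨' ψ)   e         (inj₂ h)  = inj₂ (⊨-resp-≈ᵀ ψ e h)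
⊨-resp-≈ᵀ (φ ⇒ ψ)    (_ , Y⊆X) h Z Z⊆Y    = h Z (λ v → Y⊆X v ∘ Z⊆Y v)

⊨-cong-≈ᵀ : ∀ φ {X Y} → X ≈ᵀ Y → (X ⊨ φ) ⇔ (Y ⊨ φ)
⊨-cong-≈ᵀ φ e = mk⇔ (⊨-resp-≈ᵀ φ e) (⊨-resp-≈ᵀ φ (≈ᵀ-sym e))

⊨all-resp-≈ᵀ : ∀ φs {X Y} → X ≈ᵀ Y → X ⊨all φs → Y ⊨all φs
⊨all-resp-≈ᵀ []       e h                = h
⊨all-resp-≈ᵀ (φ ∷ φs) e (inj₁ hφ , hφs) = inj₁ (⊨-resp-≈ᵀ φ e hφ) , ⊨all-resp-≈ᵀ φs e hφs
⊨all-resp-≈ᵀ (φ ∷ φs) e (inj₂ hφ , hφs) =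
  inj₂ (⊨¬-antimono φ (proj₂ e) hφ) , ⊨all-resp-≈ᵀ φs e hφs

module ImageSemantics (f : Valuation → Valuation) where

  image : Team → Team
  image X w = Σ Valuation λ v → X v × f v ≡ w

  infix 25 _∩preimage_

  _∩preimage_ : Team → Team → Team
  (X ∩preimage Z) v = X v × Z (f v)

  image-mono : ∀ {X Y} → Y ⊆ X → image Y ⊆ image X
  image-mono Y⊆X w (v , y , fv≡w) = v , Y⊆X v y , fv≡w

  ∩preimage-⊆ : ∀ X Z → X ∩preimage Z ⊆ X
  ∩preimage-⊆ X Z v (x , _) = x

  image-∩preimage : ∀ {X Z} → Z ⊆ image X → image (X ∩preimage Z) ≈ᵀ Z
  image-∩preimage {Z = Z} Z⊆fX =
    (λ { w (v , (_ , z) , fv≡w) → ≡.subst Z fv≡w z }) ,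
    (λ w z → let (v , x , fv≡w) = Z⊆fX w z in v , (x , ≡.subst Z (≡.sym fv≡w) z) , fv≡w)

  image-⟦⟧ : ∀ v → image ⟦ v ⟧ ≈ᵀ ⟦ f v ⟧
  image-⟦⟧ v = (λ { w (u , refl , fu≡w) → ≡.sym fu≡w }) , (λ { w refl → v , refl , refl })

  image-∪ : ∀ {X Y Z} → X ≐ Y ∪ Z → image X ≐ image Y ∪ image Z
  image-∪ (Y⊆X , Z⊆X , cover) =
    image-mono Y⊆X , image-mono Z⊆X , λ { w (v , x , fv≡w) → side (cover v x) fv≡w }
    where
    side : ∀ {Y Z : Team} {v w} → Y v ⊎ Z v → f v ≡ w → image Y w ⊎ image Z w
    side {v = v} (inj₁ y) fv≡w = inj₁ (v , y , fv≡w)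
    side {v = v} (inj₂ z) fv≡w = inj₂ (v , z , fv≡w)

  ∩preimage-∪ : ∀ {X Y Z} → image X ≐ Y ∪ Z → X ≐ X ∩preimage Y ∪ X ∩preimage Z
  ∩preimage-∪ {X} {Y} {Z} (_ , _ , cover) =
    ∩preimage-⊆ X Y , ∩preimage-⊆ X Z , λ v x → side x (cover (f v) (v , x , refl))
    where
    side : ∀ {v} → X v → Y (f v) ⊎ Z (f v) → (X ∩preimage Y) v ⊎ (X ∩preimage Z) v
    side x (inj₁ y) = inj₁ (x , y)
    side x (inj₂ z) = inj₂ (x , z)

  ∀⊆-image : {P′ P : Team → Set₁} → (∀ Y → P′ Y ⇔ P (image Y)) →
             (∀ {Y Z} → Y ≈ᵀ Z → P Y → P Z) →
             ∀ X → (∀ Y → Y ⊆ X → P′ Y) ⇔ (∀ Z → Z ⊆ image X → P Z)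
  ∀⊆-image {P′} {P} P′⇔P∘image P-resp X = mk⇔ forward backward
    where
    forward : (∀ Y → Y ⊆ X → P′ Y) → ∀ Z → Z ⊆ image X → P Z
    forward h Z Z⊆fX =
      P-resp (image-∩preimage Z⊆fX) (to (P′⇔P∘image _) (h (X ∩preimage Z) (∩preimage-⊆ X Z)))
    backward : (∀ Z → Z ⊆ image X → P Z) → ∀ Y → Y ⊆ X → P′ Y
    backward h Y Y⊆X = from (P′⇔P∘image Y) (h (image Y) (image-mono Y⊆X))

  Translates : Form → Form → Set₁
  Translates φ′ φ = ∀ X → (X ⊨ φ′) ⇔ (image X ⊨ φ)

  ⟦⟧-translates : ∀ {φ′ φ} → Translates φ′ φ → ∀ v → (⟦ v ⟧ ⊨ φ′) ⇔ (⟦ f v ⟧ ⊨ φ)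
  ⟦⟧-translates {φ = φ} t v = ⇔.trans (t ⟦ v ⟧) (⊨-cong-≈ᵀ φ (image-⟦⟧ v))

  ⊨¬-translates : ∀ {φ′ φ} → Translates φ′ φ → ∀ X → (X ⊨¬ φ′) ⇔ (image X ⊨¬ φ)
  ⊨¬-translates t X =
    mk⇔ (λ { h w (v , x , refl) → h v x ∘ from (⟦⟧-translates t v) })
        (λ h v x → h (f v) (v , x , refl) ∘ to (⟦⟧-translates t v))

  ⊨all-translates : ∀ {φs′ φs} → Pointwise Translates φs′ φs →
                    ∀ X → (X ⊨all φs′) ⇔ (image X ⊨all φs)
  ⊨all-translates []       X = ⇔.refl
  ⊨all-translates (t ∷ ts) X = (t X ⊎-⇔ ⊨¬-translates t X) ×-⇔ ⊨all-translates ts X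

  var-translates : ∀ {α p} → Flat α → (∀ v → (⟦ v ⟧ ⊨ α) ⇔ (f v p ≡ true)) →
                   Translates α (var p)
  var-translates α-flat α⇔p X =
    mk⇔ (λ h → lift λ { w (v , x , refl) → to (α⇔p v) (to (α-flat X) h v x) })
        (λ { (lift h) → from (α-flat X) λ v x → from (α⇔p v) (h (f v) (v , x , refl)) })

  bot-translates : Translates bot bot
  bot-translates X = mk⇔ (λ { (lift h) → lift λ { w (v , x , _) → h v x } })
                         (λ { (lift h) → lift λ v x → h (f v) (v , x , refl) })

  top-translates : Translates top top
  top-translates X = ⇔.refl

  dep-translates : ∀ {φs′ φs ψ′ ψ} → Pointwise Translates φs′ φs → Translates ψ′ ψ →
                   Translates (dep φs′ ψ′) (dep φs ψ)
  dep-translates {φs = φs} {ψ = ψ} ts t =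
    ∀⊆-image (λ Y → →-cong-⇔ (⊨all-translates ts Y) (t Y ⊎-⇔ ⊨¬-translates t Y)) resp
    where
    resp : ∀ {Y Z} → Y ≈ᵀ Z → (Y ⊨all φs → Y ⊨ ψ ⊎ Y ⊨¬ ψ) → Z ⊨all φs → Z ⊨ ψ ⊎ Z ⊨¬ ψ
    resp e h z with h (⊨all-resp-≈ᵀ φs (≈ᵀ-sym e) z)
    ... | inj₁ y = inj₁ (⊨-resp-≈ᵀ ψ e y)
    ... | inj₂ y = inj₂ (⊨¬-antimono ψ (proj₂ e) y)

  neg-translates : ∀ {φ′ φ} → Translates φ′ φ → Translates (neg φ′) (neg φ)
  neg-translates = ⊨¬-translates

  ∧-translates : ∀ {φ′ φ ψ′ ψ} → Translates φ′ φ → Translates ψ′ ψ →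
                 Translates (φ′ ∧' ψ′) (φ ∧' ψ)
  ∧-translates tφ tψ X = tφ X ×-⇔ tψ X

  ∨-translates : ∀ {φ′ φ ψ′ ψ} → Translates φ′ φ → Translates ψ′ ψ →
                 Translates (φ′ ∨' ψ′) (φ ∨' ψ)
  ∨-translates tφ tψ X = tφ X ⊎-⇔ tψ X

  ⊗-translates : ∀ {φ′ φ ψ′ ψ} → Translates φ′ φ → Translates ψ′ ψ →
                 Translates (φ′ ⊗ ψ′) (φ ⊗ ψ)
  ⊗-translates {φ = φ} {ψ = ψ} tφ tψ X = mk⇔
    (λ { (Y , Z , lift split , hY , hZ) →
         image Y , image Z , lift (image-∪ split) , to (tφ Y) hY , to (tψ Z) hZ })
    (λ { (Y , Z , lift split@(Y⊆fX , Z⊆fX , _) , hY , hZ) →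
         X ∩preimage Y , X ∩preimage Z , lift (∩preimage-∪ split) ,
         from (tφ _) (⊨-resp-≈ᵀ φ (≈ᵀ-sym (image-∩preimage Y⊆fX)) hY) ,
         from (tψ _) (⊨-resp-≈ᵀ ψ (≈ᵀ-sym (image-∩preimage Z⊆fX)) hZ) })

  ⇒-translates : ∀ {φ′ φ ψ′ ψ} → Translates φ′ φ → Translates ψ′ ψ →
                 Translates (φ′ ⇒ ψ′) (φ ⇒ ψ)
  ⇒-translates {φ = φ} {ψ = ψ} tφ tψ =
    ∀⊆-image (λ Y → →-cong-⇔ (tφ Y) (tψ Y))
             (λ e h → ⊨-resp-≈ᵀ ψ e ∘ h ∘ ⊨-resp-≈ᵀ φ (≈ᵀ-sym e))

  module _ (s : ℕ → Form) (s-flat : IsFlatSubst s)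
           (f-reads-s : ∀ v p → (⟦ v ⟧ ⊨ s p) ⇔ (f v p ≡ true)) where

    mutual
      subst-translates : ∀ φ → Translates (subst s φ) φ
      subst-translates (var p)    = var-translates (s-flat p) (λ v → f-reads-s v p)
      subst-translates bot        = bot-translates
      subst-translates top        = top-translates
      subst-translates (dep φs ψ) = dep-translates (substs-translate φs) (subst-translates ψ)
      subst-translates (neg φ)    = neg-translates (subst-translates φ)
      subst-translates (φ ∧' ψ)   = ∧-translates (subst-translates φ) (subst-translates ψ)
      subst-translates (φ ⊗ ψ)    = ⊗-translates (subst-translates φ) (subst-translates ψ)
      subst-translates (φ ∨' ψ)   = ∨-translates (subst-translates φ) (subst-translates ψ)
      subst-translates (φ ⇒ ψ)    = ⇒-translates (subst-translates φ) (subst-translates ψ)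

      substs-translate : ∀ φs → Pointwise Translates (substs s φs) φs
      substs-translate []       = []
      substs-translate (φ ∷ φs) = subst-translates φ ∷ substs-translate φs

module _ (em : ExcludedMiddle (suc 0ℓ)) (s : ℕ → Form) where

  substValuation : Valuation → Valuation
  substValuation v p = does (em {⟦ v ⟧ ⊨ s p})

  substValuation-reads-s : ∀ v p → (⟦ v ⟧ ⊨ s p) ⇔ (substValuation v p ≡ true)
  substValuation-reads-s v p with em {⟦ v ⟧ ⊨ s p}
  ... | yes h = mk⇔ (λ _ → refl) (λ _ → h)
  ... | no ¬h = mk⇔ (λ h → ⊥-elim (¬h h)) (λ ())

theorem3p7 : ExcludedMiddle (suc 0ℓ) →
    (L : Logic) (s : ℕ → Form) → IsSubstOf L s → IsFlatSubst s →
    (∀ φ ψ → φ ⊢[ L ] ψ → subst s φ ⊢[ L ] subst s ψ)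
    × (∀ φ ψ → In L φ → In L ψ → φ ≋ ψ → subst s φ ≋ subst s ψ)
theorem3p7 em L s s-in-L s-flat = entailment , equivalence
  where
  open ImageSemantics (substValuation em s)

  translates : ∀ φ → Translates (subst s φ) φ
  translates = subst-translates s s-flat (substValuation-reads-s em s)

  entailment : ∀ φ ψ → φ ⊢[ L ] ψ → subst s φ ⊢[ L ] subst s ψ
  entailment φ ψ (φ-in-L , ψ-in-L , φ⊨ψ) =
    s-in-L φ φ-in-L , s-in-L ψ ψ-in-L ,
    λ X → from (translates ψ X) ∘ φ⊨ψ (image X) ∘ to (translates φ X)

  equivalence : ∀ φ ψ → In L φ → In L ψ → φ ≋ ψ → subst s φ ≋ subst s ψ
  equivalence φ ψ _ _ φ≋ψ X =
    ⇔.trans (translates φ X) (⇔.trans (φ≋ψ (image X)) (⇔.sym (translates ψ X)))
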